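{- For all integers $n\ge 1$ and $k\ge 0$, $$\Delta\, \mathcal{Z}_{n,k}(q,v) = (-1)^k\,\widehat{\mathcal{Z}}_{n,k}(q,-v),$$ where $\Delta$ acts on the coefficients in $\mathcal{U}_{n,k}$ (extended $\mathbb{C}[q,v]$-linearly), with all objects as defined in the context.
   Context: Let $\Upsilon_{n,k}$ be the set of undirected graphs with vertices $1,\dots,n$ and $k$ numbered edges, i.e. sequences $G=(\{a_1,b_1\},\dots,\{a_k,b_k\})$ with $a_i,b_i\in\{1,\dots,n\}$ (loops $\{a,a\}$ and repeated edges allowed). Let $\mathcal{U}_{n,k}$ be the complex vector space with basis $\Upsilon_{n,k}$. For a graph $G$ with $k$ edges, its Potts polynomial is $Z_G(q,v)=(v+1)^k C_G(q,1/(v+1))$, where $C_G(q,y)=\sum_{f:\{1,\dots,n\}\to\{1,\dots,q\}} y^{\#\{\text{edges }\{a,b\}\text{ of }G:\ f(a)\neq f(b)\}}$; equivalently $Z_G(q,v)=\sum_{f}(1+v)^{\#\{\text{edges }\{a,b\}:\ f(a)=f(b)\}}$, a polynomial in $q,v$. For $G\in\Upsilon_{n,k}$, $\widehat G$ denotes $G$ with all loops deleted (remaining edges renumbered consecutively preserving order). Define $$\mathcal{Z}_{n,k}(q,v)=\sum_{G\in\Upsilon_{n,k}} Z_{\widehat G}(q,v)\,G,\qquad \widehat{\mathcal{Z}}_{n,k}(q,v)=\sum_{G\in\Upsilon_{n,k},\ G\text{ has no loops}} Z_G(q,v)\,G.$$ Laplace operator: for $i\in\{1,\dots,k\}$ let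 $B_i:\mathcal{U}_{n,k}\to\mathcal{U}_{n,k}$ be linear, defined on $G\in\Upsilon_{n,k}$ with $i$-th edge $\{a,b\}$ by $B_i(G)=G$ if $a\neq b$, and $B_i(G)=-\sum_{m\neq a} G_{i\to\{a,m\}}$ if $a=b$, where $G_{i\to\{a,m\}}$ is $G$ with its $i$-th edge replaced by $\{a,m\}$ (keeping number $i$) and the sum is over $m\in\{1,\dots,n\}\setminus\{a\}$. Then $\Delta=B_1\cdots B_k$. (Equivalently, $\Delta(G)$ is obtained by orienting the edges of $G$ arbitrarily, applying the directed Laplace operator, and forgetting orientations.) -}

module Defs where

open import Data.Nat as ℕ using (ℕ; zero; suc)
open import Data.Integer as ℤ using (ℤ; 1ℤ; -1ℤ; 0ℤ)
open import Data.Fin using (Fin; _≟_; toℕ)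
open import Data.Fin.Properties using () renaming (_≟_ to _≟F_)
open import Data.Nat.Properties using () renaming (_≤?_ to _≤ℕ?_)
open import Data.Bool using (Bool; true; false; _∧_; _∨_; not; if_then_else_)
open import Data.Product using (_×_; _,_; proj₁; proj₂)
open import Data.List as List using (List; []; _∷_; map; concatMap; filter; foldr)
open import Data.Vec as Vec using (Vec; []; _∷_; lookup; _[_]≔_; toList)
open import Data.Fin using (Fin)
open import Data.Fin.Base using () 
open import Data.List.Base using (allFin)
open import Relation.Nullary.Decidable using (⌊_⌋; ¬?)

-- An (unordered) edge {a,b} is represented by a pair (a , b); two pairs
-- represent the same edge iff they agree up to swapping.
Edge : ℕ → Set
Edge n = Fin n × Fin n

Graph : ℕ → ℕ → Set
Graph n k = Vec (Edge n) k

_==_ : ∀ {n} → Fin n → Fin n → Bool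
a == b = ⌊ a ≟ b ⌋

sameEdge : ∀ {n} → Edge n → Edge n → Bool
sameEdge (a , b) (c , d) = ((a == c) ∧ (b == d)) ∨ ((a == d) ∧ (b == c))

sameGraph : ∀ {n k} → Graph n k → Graph n k → Bool
sameGraph [] [] = true
sameGraph (e ∷ G) (f ∷ H) = sameEdge e f ∧ sameGraph G H

isLoop : ∀ {n} → Edge n → Bool
isLoop (a , b) = a == b

loopless : ∀ {n k} → Graph n k → Bool
loopless [] = true
loopless (e ∷ G) = not (isLoop e) ∧ loopless G

-- The standard basis Υ_{n,k}: each unordered edge {a,b} listed once,
-- as (a , b) with a ≤ b.
allEdges : (n : ℕ) → List (Edge n)
allEdges n = concatMap (λ a → map (λ b → (a , b))
                 (filter (λ b → toℕ a ≤ℕ? toℕ b) (allFin n))) (allFin n)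

allGraphs : (n k : ℕ) → List (Graph n k)
allGraphs n zero = [] ∷ []
allGraphs n (suc k) = concatMap (λ e → map (e ∷_) (allGraphs n k)) (allEdges n)

sumℤ : List ℤ → ℤ
sumℤ = foldr ℤ._+_ 0ℤ

allColourings : (n q : ℕ) → List (Vec (Fin q) n)
allColourings zero q = [] ∷ []
allColourings (suc n) q =
  concatMap (λ c → map (c ∷_) (allColourings n q)) (allFin q)

monoCount : ∀ {n q} → Vec (Fin q) n → List (Edge n) → ℕ
monoCount f [] = 0
monoCount f ((a , b) ∷ es) =
  (if lookup f a == lookup f b then 1 else 0) ℕ.+ monoCount f es

Potts : ∀ {n} → ℕ → ℤ → List (Edge n) → ℤ
Potts {n} q v E =
  sumℤ (map (λ f → (1ℤ ℤ.+ v) ℤ.^ monoCount f E) (allColourings n q))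

deleteLoops : ∀ {n k} → Graph n k → List (Edge n)
deleteLoops G = filter (λ e → ¬? (Data.Fin.Properties._≟_ (proj₁ e) (proj₂ e))) (toList G)
  where import Data.Fin.Properties

-- Elements of U_{n,k} (with ℤ-coefficients) as formal linear combinations.
LC : ℕ → ℕ → Set
LC n k = List (ℤ × Graph n k)

coeff : ∀ {n k} → LC n k → Graph n k → ℤ
coeff [] H = 0ℤ
coeff ((c , G) ∷ xs) H = (if sameGraph G H then c else 0ℤ) ℤ.+ coeff xs H

linExt : ∀ {n k} → (Graph n k → LC n k) → LC n k → LC n k
linExt f xs = concatMap (λ cG → map (λ dH → (proj₁ cG ℤ.* proj₁ dH , proj₂ dH)) (f (proj₂ cG))) xs

B : ∀ {n k} → Fin k → Graph n k → LC n k
B {n} i G with lookup G i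
... | (a , b) = if a == b
      then map (λ m → (-1ℤ , G [ i ]≔ (a , m))) (filter (λ m → ¬? (m ≟ a)) (allFin n))
      else (1ℤ , G) ∷ []

Δ : ∀ {n k} → LC n k → LC n k
Δ {n} {k} x = foldr (λ i acc → linExt (B i) acc) x (allFin k)

𝒵 : (n k : ℕ) → ℕ → ℤ → LC n k
𝒵 n k q v = map (λ G → (Potts q v (deleteLoops G) , G)) (allGraphs n k)

𝒵̂ : (n k : ℕ) → ℕ → ℤ → LC n k
𝒵̂ n k q v = map (λ G → (Potts q v (toList G) , G)) (filter (λ G → loopless G Data.Bool.≟ true) (allGraphs n k))
  where import Data.Bool

{-# OPTIONS --safe #-}
-- Taking the coefficient of a graph H turns B_i into an operator Bᵀ i on coefficient
-- functions g : Graph n k → ℤ: if the i-th edge {c,d} of H is a loop then Bᵀ i g H = 0,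
-- and otherwise Bᵀ i g H = g H − g (H with edge i set to {c,c}) − g (H with edge i set to {d,d}).
-- The coefficient of H in 𝒵 is Σ_f Π_e w_f(e), where a loop has weight 1 and an edge {a,b}
-- has weight 1+v or 1 according as f a = f b.  Since Bᵀ i only looks at edge i, Δᵀ acts on
-- this product edge by edge: a loop factor becomes 0 and a non-loop factor w becomes
-- w − 1 − 1 = −(1−v) or −1.  The result is (−1)^k times the weight of H in 𝒵̂ at −v.
module Submission where

open import Defs
open import Data.Nat using (ℕ; _≥_)
open import Data.Integer using (ℤ; -_; -1ℤ; _*_; _^_)
open import Relation.Binary.PropositionalEquality using (_≡_)

open import Data.Bool using (Bool; true; false; _∧_; _∨_; if_then_else_)
import Data.Bool as Bool
open import Data.Bool.Properties using (∧-assoc; ∧-comm; ∨-comm; ∨-identityʳ; if-cong; if-cong-else; if-eta)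
open import Data.Empty using (⊥-elim)
open import Data.Fin using (Fin; zero; suc; toℕ)
open import Data.Fin.Properties using (_≟_; toℕ-injective)
open import Data.Integer using (_+_; _-_; 0ℤ; 1ℤ)
import Data.Integer.Properties as ℤ
open import Algebra.Properties.CommutativeSemigroup ℤ.*-commutativeSemigroup using (x∙yz≈y∙xz)
open import Data.Integer.Tactic.RingSolver using (solve-∀)
open import Data.List using (List; []; _∷_; _++_; map; filter; concatMap; foldr; tabulate; allFin)
open import Data.List.Properties using (map-tabulate)
open import Data.Nat as ℕ using (_≤_)
open import Data.Nat.Properties using (_≤?_; ≤-antisym; ≰⇒≥)
open import Data.Product using (_,_; proj₁; proj₂; swap)
open import Data.Sum using (_⊎_; inj₁; inj₂)
open import Data.Vec using (Vec; []; _∷_; lookup; _[_]≔_; toList)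
open import Data.Vec.Properties using ([]≔-lookup)
open import Function using (id; _∘_)
open import Relation.Binary.PropositionalEquality using (_≢_; refl; sym; trans; cong; cong₂; module ≡-Reasoning)
open import Relation.Nullary using (yes; no)
open import Relation.Nullary.Decidable using (⌊_⌋; ¬?; isYes≗does; dec-true)
open import Relation.Unary using (Decidable)

open ≡-Reasoning

∑ : {A : Set} → List A → (A → ℤ) → ℤ
∑ xs f = sumℤ (map f xs)

syntax ∑ xs (λ x → e) = ∑[ x ∈ xs ] e

𝟙 : Bool → ℤ
𝟙 b = if b then 1ℤ else 0ℤ

𝟙-∧ : ∀ b c → 𝟙 (b ∧ c) ≡ 𝟙 b * 𝟙 c
𝟙-∧ true  c = sym (ℤ.*-identityˡ (𝟙 c))
𝟙-∧ false c = refl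

module _ {A : Set} where

  ∑-cong : ∀ (xs : List A) {f g : A → ℤ} → (∀ x → f x ≡ g x) → ∑ xs f ≡ ∑ xs g
  ∑-cong []       f≗g = refl
  ∑-cong (x ∷ xs) f≗g = cong₂ _+_ (f≗g x) (∑-cong xs f≗g)

  ∑-zero : ∀ (xs : List A) → ∑[ x ∈ xs ] 0ℤ ≡ 0ℤ
  ∑-zero []       = refl
  ∑-zero (x ∷ xs) = trans (ℤ.+-identityˡ _) (∑-zero xs)

  ∑-≗0 : ∀ (xs : List A) {f : A → ℤ} → (∀ x → f x ≡ 0ℤ) → ∑ xs f ≡ 0ℤ
  ∑-≗0 xs f≗0 = trans (∑-cong xs f≗0) (∑-zero xs)

  ∑-++ : ∀ (xs ys : List A) f → ∑ (xs ++ ys) f ≡ ∑ xs f + ∑ ys f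
  ∑-++ []       ys f = sym (ℤ.+-identityˡ _)
  ∑-++ (x ∷ xs) ys f = trans (cong (f x +_) (∑-++ xs ys f)) (sym (ℤ.+-assoc (f x) _ _))

  ∑-*ˡ : ∀ (xs : List A) c f → ∑[ x ∈ xs ] (c * f x) ≡ c * ∑ xs f
  ∑-*ˡ []       c f = sym (ℤ.*-zeroʳ c)
  ∑-*ˡ (x ∷ xs) c f = trans (cong (c * f x +_) (∑-*ˡ xs c f)) (sym (ℤ.*-distribˡ-+ c (f x) _))

  ∑-minus : ∀ (xs : List A) f g → ∑[ x ∈ xs ] (f x - g x) ≡ ∑ xs f - ∑ xs g
  ∑-minus []       f g = refl
  ∑-minus (x ∷ xs) f g = trans (cong (f x - g x +_) (∑-minus xs f g)) (interchange (f x) (g x) _ _)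
    where
    interchange : ∀ a b s t → (a - b) + (s - t) ≡ (a + s) - (b + t)
    interchange = solve-∀

  ∑-map : ∀ {B : Set} (g : B → A) ys f → ∑ (map g ys) f ≡ ∑[ y ∈ ys ] f (g y)
  ∑-map g []       f = refl
  ∑-map g (y ∷ ys) f = cong (f (g y) +_) (∑-map g ys f)

  ∑-concatMap : ∀ {B : Set} (g : B → List A) ys f → ∑ (concatMap g ys) f ≡ ∑[ y ∈ ys ] ∑ (g y) f
  ∑-concatMap g []       f = refl
  ∑-concatMap g (y ∷ ys) f = trans (∑-++ (g y) (concatMap g ys) f) (cong (∑ (g y) f +_) (∑-concatMap g ys f))

  ∑-filter : ∀ {P : A → Set} (P? : Decidable P) xs f →
             ∑ (filter P? xs) f ≡ ∑[ x ∈ xs ] (if ⌊ P? x ⌋ then f x else 0ℤ)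
  ∑-filter P? []       f = refl
  ∑-filter P? (x ∷ xs) f with P? x
  ... | yes _ = cong (f x +_) (∑-filter P? xs f)
  ... | no  _ = trans (∑-filter P? xs f) (sym (ℤ.+-identityˡ _))

∑-allFin-suc : ∀ {n} f → ∑ (allFin (ℕ.suc n)) f ≡ f zero + ∑[ m ∈ allFin n ] f (suc m)
∑-allFin-suc {n} f = cong (f zero +_) (begin
  ∑ (tabulate suc) f         ≡⟨ cong (λ ms → ∑ ms f) (sym (map-tabulate id suc)) ⟩
  ∑ (map suc (allFin n)) f   ≡⟨ ∑-map suc (allFin n) f ⟩
  ∑[ m ∈ allFin n ] f (suc m) ∎)

suc==suc : ∀ {n} (m x : Fin n) → (suc m == suc x) ≡ (m == x)
suc==suc m x = trans (isYes≗does (suc m ≟ suc x)) (sym (isYes≗does (m ≟ x)))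

∑-𝟙-== : ∀ {n} (x : Fin n) → ∑[ m ∈ allFin n ] 𝟙 (m == x) ≡ 1ℤ
∑-𝟙-== {ℕ.suc n} zero = trans (∑-allFin-suc {n} (λ m → 𝟙 (m == zero))) (cong (1ℤ +_) (∑-zero (allFin n)))
∑-𝟙-== {ℕ.suc n} (suc x) = begin
  ∑[ m ∈ allFin (ℕ.suc n) ] 𝟙 (m == suc x)   ≡⟨ ∑-allFin-suc (λ m → 𝟙 (m == suc x)) ⟩
  0ℤ + ∑[ m ∈ allFin n ] 𝟙 (suc m == suc x)  ≡⟨ ℤ.+-identityˡ _ ⟩
  ∑[ m ∈ allFin n ] 𝟙 (suc m == suc x)       ≡⟨ ∑-cong (allFin n) (λ m → cong 𝟙 (suc==suc m x)) ⟩
  ∑[ m ∈ allFin n ] 𝟙 (m == x)               ≡⟨ ∑-𝟙-== x ⟩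
  1ℤ                                          ∎

Bᵀ-edge : ∀ {n} → (Edge n → ℤ) → Edge n → ℤ
Bᵀ-edge u (c , d) = if c == d then 0ℤ else u (c , d) - u (c , c) - u (d , d)

-- The first term is g (H [ i ]≔ lookup H i), which is g H only up to []≔-lookup.
Bᵀ : ∀ {n k} → Fin k → (Graph n k → ℤ) → Graph n k → ℤ
Bᵀ i g H = Bᵀ-edge (λ e → g (H [ i ]≔ e)) (lookup H i)

Bsᵀ : ∀ {n k} → List (Fin k) → (Graph n k → ℤ) → Graph n k → ℤ
Bsᵀ is g = foldr Bᵀ g is

Δᵀ : ∀ {n k} → (Graph n k → ℤ) → Graph n k → ℤ
Δᵀ {k = k} = Bsᵀ (allFin k)

module _ {n : ℕ} where

  Bᵀ-edge-cong : ∀ {u u′ : Edge n → ℤ} → (∀ e → u e ≡ u′ e) → ∀ h → Bᵀ-edge u h ≡ Bᵀ-edge u′ h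
  Bᵀ-edge-cong u≗u′ (c , d) = if-cong-else (c == d) (cong₂ _-_ (cong₂ _-_ (u≗u′ _) (u≗u′ _)) (u≗u′ _))

  Bᵀ-edge-*ˡ : ∀ a (u : Edge n → ℤ) h → Bᵀ-edge (λ e → a * u e) h ≡ a * Bᵀ-edge u h
  Bᵀ-edge-*ˡ a u (c , d) with c == d
  ... | true  = sym (ℤ.*-zeroʳ a)
  ... | false = distrib a (u (c , d)) (u (c , c)) (u (d , d))
    where
    distrib : ∀ a x y z → a * x - a * y - a * z ≡ a * (x - y - z)
    distrib = solve-∀

  Bᵀ-edge-*ʳ : ∀ a (u : Edge n → ℤ) h → Bᵀ-edge (λ e → u e * a) h ≡ Bᵀ-edge u h * a
  Bᵀ-edge-*ʳ a u h = begin
    Bᵀ-edge (λ e → u e * a) h  ≡⟨ Bᵀ-edge-cong (λ e → ℤ.*-comm (u e) a) h ⟩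
    Bᵀ-edge (λ e → a * u e) h  ≡⟨ Bᵀ-edge-*ˡ a u h ⟩
    a * Bᵀ-edge u h            ≡⟨ ℤ.*-comm a _ ⟩
    Bᵀ-edge u h * a            ∎

  Bᵀ-edge-∑ : ∀ {A : Set} (xs : List A) (u : A → Edge n → ℤ) h →
              Bᵀ-edge (λ e → ∑[ x ∈ xs ] u x e) h ≡ ∑[ x ∈ xs ] Bᵀ-edge (u x) h
  Bᵀ-edge-∑ xs u (c , d) with c == d
  ... | true  = sym (∑-zero xs)
  ... | false = sym (begin
    ∑[ x ∈ xs ] (u x (c , d) - u x (c , c) - u x (d , d))
      ≡⟨ ∑-minus xs (λ x → u x (c , d) - u x (c , c)) (λ x → u x (d , d)) ⟩
    ∑[ x ∈ xs ] (u x (c , d) - u x (c , c)) - ∑[ x ∈ xs ] u x (d , d)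
      ≡⟨ cong (_- ∑[ x ∈ xs ] u x (d , d)) (∑-minus xs (λ x → u x (c , d)) (λ x → u x (c , c))) ⟩
    ∑[ x ∈ xs ] u x (c , d) - ∑[ x ∈ xs ] u x (c , c) - ∑[ x ∈ xs ] u x (d , d) ∎)

module _ {n k : ℕ} where

  Bsᵀ-cong : ∀ (is : List (Fin k)) {g g′ : Graph n k → ℤ} → (∀ G → g G ≡ g′ G) →
             ∀ H → Bsᵀ is g H ≡ Bsᵀ is g′ H
  Bsᵀ-cong []       g≗g′ H = g≗g′ H
  Bsᵀ-cong (i ∷ is) g≗g′ H = Bᵀ-edge-cong (λ e → Bsᵀ-cong is g≗g′ (H [ i ]≔ e)) (lookup H i)

  Bsᵀ-*ˡ : ∀ (is : List (Fin k)) a (g : Graph n k → ℤ) H →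
           Bsᵀ is (λ G → a * g G) H ≡ a * Bsᵀ is g H
  Bsᵀ-*ˡ []       a g H = refl
  Bsᵀ-*ˡ (i ∷ is) a g H = trans (Bᵀ-edge-cong (λ e → Bsᵀ-*ˡ is a g (H [ i ]≔ e)) (lookup H i))
                                (Bᵀ-edge-*ˡ a (λ e → Bsᵀ is g (H [ i ]≔ e)) (lookup H i))

  Bsᵀ-∑ : ∀ (is : List (Fin k)) {A : Set} (xs : List A) (g : A → Graph n k → ℤ) H →
          Bsᵀ is (λ G → ∑[ x ∈ xs ] g x G) H ≡ ∑[ x ∈ xs ] Bsᵀ is (g x) H
  Bsᵀ-∑ []       xs g H = refl
  Bsᵀ-∑ (i ∷ is) xs g H = trans (Bᵀ-edge-cong (λ e → Bsᵀ-∑ is xs g (H [ i ]≔ e)) (lookup H i))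
                                (Bᵀ-edge-∑ xs (λ x e → Bsᵀ is (g x) (H [ i ]≔ e)) (lookup H i))

  Bsᵀ-map-suc : ∀ (is : List (Fin k)) (g : Graph n (ℕ.suc k) → ℤ) e H →
                Bsᵀ (map suc is) g (e ∷ H) ≡ Bsᵀ is (g ∘ (e ∷_)) H
  Bsᵀ-map-suc []       g e H = refl
  Bsᵀ-map-suc (i ∷ is) g e H = Bᵀ-edge-cong (λ e′ → Bsᵀ-map-suc is g e (H [ i ]≔ e′)) (lookup H i)

∏ : ∀ {n k} → (Edge n → ℤ) → Graph n k → ℤ
∏ u []      = 1ℤ
∏ u (e ∷ G) = u e * ∏ u G

Δᵀ-∏ : ∀ {n} k (u : Edge n → ℤ) (H : Graph n k) → Δᵀ (∏ u) H ≡ ∏ (Bᵀ-edge u) H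
Δᵀ-∏ ℕ.zero    u []      = refl
Δᵀ-∏ (ℕ.suc k) u (e ∷ H) = trans (Bᵀ-edge-cong restrict e) (Bᵀ-edge-*ʳ (∏ (Bᵀ-edge u) H) u e)
  where
  restrict : ∀ e′ → Bsᵀ (tabulate suc) (∏ u) (e′ ∷ H) ≡ u e′ * ∏ (Bᵀ-edge u) H
  restrict e′ = begin
    Bsᵀ (tabulate suc) (∏ u) (e′ ∷ H)        ≡⟨ cong (λ is → Bsᵀ is (∏ u) (e′ ∷ H)) (sym (map-tabulate id suc)) ⟩
    Bsᵀ (map suc (allFin k)) (∏ u) (e′ ∷ H)  ≡⟨ Bsᵀ-map-suc (allFin k) (∏ u) e′ H ⟩
    Bsᵀ (allFin k) (λ G → u e′ * ∏ u G) H    ≡⟨ Bsᵀ-*ˡ (allFin k) (u e′) (∏ u) H ⟩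
    u e′ * Δᵀ (∏ u) H                        ≡⟨ cong (u e′ *_) (Δᵀ-∏ k u H) ⟩
    u e′ * ∏ (Bᵀ-edge u) H                   ∎

∏-cong : ∀ {n k} {u u′ : Edge n → ℤ} → (∀ e → u e ≡ u′ e) → (G : Graph n k) → ∏ u G ≡ ∏ u′ G
∏-cong u≗u′ []      = refl
∏-cong u≗u′ (e ∷ G) = cong₂ _*_ (u≗u′ e) (∏-cong u≗u′ G)

∏-*ˡ : ∀ {n} k a (u : Edge n → ℤ) (G : Graph n k) → ∏ (λ e → a * u e) G ≡ a ^ k * ∏ u G
∏-*ˡ ℕ.zero    a u []      = refl
∏-*ˡ (ℕ.suc k) a u (e ∷ G) = trans (cong (a * u e *_) (∏-*ˡ k a u G)) (regroup a (u e) (a ^ k) (∏ u G))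
  where
  regroup : ∀ a x p y → (a * x) * (p * y) ≡ (a * p) * (x * y)
  regroup = solve-∀

coeff-∑ : ∀ {n k} (x : LC n k) H → coeff x H ≡ ∑[ cG ∈ x ] (proj₁ cG * 𝟙 (sameGraph (proj₂ cG) H))
coeff-∑ []            H = refl
coeff-∑ ((c , G) ∷ x) H = cong₂ _+_ (if-then-0 (sameGraph G H)) (coeff-∑ x H)
  where
  if-then-0 : ∀ b → (if b then c else 0ℤ) ≡ c * 𝟙 b
  if-then-0 true  = sym (ℤ.*-identityʳ c)
  if-then-0 false = sym (ℤ.*-zeroʳ c)

coeff-map : ∀ {n k} {A : Set} (c : A → ℤ) (F : A → Graph n k) xs H →
            coeff (map (λ x → (c x , F x)) xs) H ≡ ∑[ x ∈ xs ] (c x * 𝟙 (sameGraph (F x) H))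
coeff-map c F xs H = trans (coeff-∑ (map (λ x → (c x , F x)) xs) H) (∑-map (λ x → (c x , F x)) xs _)

coeff-++ : ∀ {n k} (x y : LC n k) H → coeff (x ++ y) H ≡ coeff x H + coeff y H
coeff-++ []            y H = sym (ℤ.+-identityˡ _)
coeff-++ ((c , G) ∷ x) y H =
  trans (cong (term +_) (coeff-++ x y H)) (sym (ℤ.+-assoc term (coeff x H) (coeff y H)))
  where
  term : ℤ
  term = if sameGraph G H then c else 0ℤ

coeff-*ˡ : ∀ {n k} a (x : LC n k) H → coeff (map (λ dH → (a * proj₁ dH , proj₂ dH)) x) H ≡ a * coeff x H
coeff-*ˡ a []            H = sym (ℤ.*-zeroʳ a)
coeff-*ˡ a ((d , G) ∷ x) H =
  trans (cong₂ _+_ (if-*ˡ (sameGraph G H)) (coeff-*ˡ a x H)) (sym (ℤ.*-distribˡ-+ a _ _))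
  where
  if-*ˡ : ∀ b → (if b then a * d else 0ℤ) ≡ a * (if b then d else 0ℤ)
  if-*ˡ true  = refl
  if-*ˡ false = sym (ℤ.*-zeroʳ a)

coeff-linExt : ∀ {n k} (f : Graph n k → LC n k) x H →
               coeff (linExt f x) H ≡ ∑[ cG ∈ x ] (proj₁ cG * coeff (f (proj₂ cG)) H)
coeff-linExt f []            H = refl
coeff-linExt f ((c , G) ∷ x) H =
  trans (coeff-++ (map (λ dH → (c * proj₁ dH , proj₂ dH)) (f G)) (linExt f x) H)
        (cong₂ _+_ (coeff-*ˡ c (f G) H) (coeff-linExt f x H))

sameExcept : ∀ {n k} → Fin k → Graph n k → Graph n k → Bool
sameExcept zero    (_ ∷ G) (_ ∷ H) = sameGraph G H
sameExcept (suc i) (e ∷ G) (f ∷ H) = sameEdge e f ∧ sameExcept i G H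

module _ {n : ℕ} where

  sameGraph-[]≔ʳ : ∀ {k} (i : Fin k) (G H : Graph n k) h →
                   sameGraph G (H [ i ]≔ h) ≡ sameExcept i G H ∧ sameEdge (lookup G i) h
  sameGraph-[]≔ʳ zero    (e ∷ G) (f ∷ H) h = ∧-comm (sameEdge e h) (sameGraph G H)
  sameGraph-[]≔ʳ (suc i) (e ∷ G) (f ∷ H) h =
    trans (cong (sameEdge e f ∧_) (sameGraph-[]≔ʳ i G H h)) (sym (∧-assoc (sameEdge e f) _ _))

  sameGraph-[]≔ˡ : ∀ {k} (i : Fin k) (G H : Graph n k) e →
                   sameGraph (G [ i ]≔ e) H ≡ sameExcept i G H ∧ sameEdge e (lookup H i)
  sameGraph-[]≔ˡ zero    (e ∷ G) (f ∷ H) e′ = ∧-comm (sameEdge e′ f) (sameGraph G H)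
  sameGraph-[]≔ˡ (suc i) (e ∷ G) (f ∷ H) e′ =
    trans (cong (sameEdge e f ∧_) (sameGraph-[]≔ˡ i G H e′)) (sym (∧-assoc (sameEdge e f) _ _))

  sameEdge-loopʳ : ∀ {a b : Fin n} → a ≢ b → ∀ c → sameEdge (a , b) (c , c) ≡ false
  sameEdge-loopʳ {a} {b} a≢b c with a ≟ c | b ≟ c
  ... | yes refl | yes refl = ⊥-elim (a≢b refl)
  ... | yes _    | no _     = refl
  ... | no _     | _        = refl

  B-edge-coeff : Edge n → Edge n → ℤ
  B-edge-coeff (a , b) h =
    if a == b then ∑[ m ∈ filter (λ m → ¬? (m ≟ a)) (allFin n) ] (-1ℤ * 𝟙 (sameEdge (a , m) h))
    else 𝟙 (sameEdge (a , b) h)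

  ∑-neighbour-== : ∀ {a x : Fin n} → a ≢ x →
    ∑[ m ∈ allFin n ] (if ⌊ ¬? (m ≟ a) ⌋ then -1ℤ * 𝟙 (m == x) else 0ℤ) ≡ -1ℤ
  ∑-neighbour-== {a} {x} a≢x = begin
    ∑[ m ∈ allFin n ] (if ⌊ ¬? (m ≟ a) ⌋ then -1ℤ * 𝟙 (m == x) else 0ℤ) ≡⟨ ∑-cong (allFin n) unguard ⟩
    ∑[ m ∈ allFin n ] (-1ℤ * 𝟙 (m == x))                              ≡⟨ ∑-*ˡ (allFin n) -1ℤ _ ⟩
    -1ℤ * ∑[ m ∈ allFin n ] 𝟙 (m == x)                                ≡⟨ cong (-1ℤ *_) (∑-𝟙-== x) ⟩
    -1ℤ                                                                ∎
    where
    unguard : ∀ m → (if ⌊ ¬? (m ≟ a) ⌋ then -1ℤ * 𝟙 (m == x) else 0ℤ) ≡ -1ℤ * 𝟙 (m == x)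
    unguard m with m ≟ a | m ≟ x
    ... | yes refl | yes refl = ⊥-elim (a≢x refl)
    ... | yes _    | no _     = refl
    ... | no _     | _        = refl

  ∑-neighbours : ∀ (a : Fin n) h →
    ∑[ m ∈ allFin n ] (if ⌊ ¬? (m ≟ a) ⌋ then -1ℤ * 𝟙 (sameEdge (a , m) h) else 0ℤ)
      ≡ Bᵀ-edge (𝟙 ∘ sameEdge (a , a)) h
  ∑-neighbours a (c , d) with c ≟ d
  ... | yes refl = ∑-≗0 (allFin n) no-neighbour-on-loop
    where
    no-neighbour-on-loop : ∀ m → (if ⌊ ¬? (m ≟ a) ⌋ then -1ℤ * 𝟙 (sameEdge (a , m) (c , c)) else 0ℤ) ≡ 0ℤ
    no-neighbour-on-loop m with m ≟ a | a ≟ c | m ≟ c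
    ... | yes _    | _        | _        = refl
    ... | no m≢a   | yes refl | yes refl = ⊥-elim (m≢a refl)
    ... | no _     | yes _    | no _     = refl
    ... | no _     | no _     | _        = refl
  ... | no c≢d with a ≟ c | a ≟ d
  ...   | yes refl | yes refl = ⊥-elim (c≢d refl)
  ...   | yes refl | no a≢d   =
    trans (∑-cong (allFin n) drop-∨-false) (∑-neighbour-== a≢d)
    where
    drop-∨-false : ∀ m → (if ⌊ ¬? (m ≟ a) ⌋ then -1ℤ * 𝟙 ((m == d) ∨ false) else 0ℤ)
                        ≡ (if ⌊ ¬? (m ≟ a) ⌋ then -1ℤ * 𝟙 (m == d) else 0ℤ)
    drop-∨-false m = cong (λ b → if ⌊ ¬? (m ≟ a) ⌋ then -1ℤ * 𝟙 b else 0ℤ) (∨-identityʳ (m == d))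
  ...   | no a≢c   | yes refl = ∑-neighbour-== a≢c
  ...   | no _     | no _     = ∑-≗0 (allFin n) (λ m → if-eta ⌊ ¬? (m ≟ a) ⌋)

  B-edge-coeff≡Bᵀ-edge : ∀ e h → B-edge-coeff e h ≡ Bᵀ-edge (𝟙 ∘ sameEdge e) h
  B-edge-coeff≡Bᵀ-edge (a , b) h with a ≟ b
  ... | yes refl = trans (∑-filter (λ m → ¬? (m ≟ a)) (allFin n) _) (∑-neighbours a h)
  ... | no a≢b   = nonloop h
    where
    nonloop : ∀ h → 𝟙 (sameEdge (a , b) h) ≡ Bᵀ-edge (𝟙 ∘ sameEdge (a , b)) h
    nonloop (c , d) with c ≟ d
    ... | yes refl = cong 𝟙 (sameEdge-loopʳ a≢b c)
    ... | no _     = sym (begin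
      𝟙 (sameEdge (a , b) (c , d)) - 𝟙 (sameEdge (a , b) (c , c)) - 𝟙 (sameEdge (a , b) (d , d))
        ≡⟨ cong₂ (λ x y → 𝟙 (sameEdge (a , b) (c , d)) - 𝟙 x - 𝟙 y) (sameEdge-loopʳ a≢b c) (sameEdge-loopʳ a≢b d) ⟩
      𝟙 (sameEdge (a , b) (c , d)) - 0ℤ - 0ℤ
        ≡⟨ minus-zeros _ ⟩
      𝟙 (sameEdge (a , b) (c , d)) ∎)
      where
      minus-zeros : ∀ x → x - 0ℤ - 0ℤ ≡ x
      minus-zeros = solve-∀

module _ {n k : ℕ} where

  coeff-B-sameExcept : ∀ (i : Fin k) (G H : Graph n k) →
    coeff (B i G) H ≡ 𝟙 (sameExcept i G H) * B-edge-coeff (lookup G i) (lookup H i)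
  coeff-B-sameExcept i G H with proj₁ (lookup G i) == proj₂ (lookup G i)
  ... | true = begin
    coeff (map (λ m → (-1ℤ , G [ i ]≔ (a , m))) neighbours) H
      ≡⟨ coeff-map (λ _ → -1ℤ) (λ m → G [ i ]≔ (a , m)) neighbours H ⟩
    ∑[ m ∈ neighbours ] (-1ℤ * 𝟙 (sameGraph (G [ i ]≔ (a , m)) H))
      ≡⟨ ∑-cong neighbours factor ⟩
    ∑[ m ∈ neighbours ] (𝟙 R * (-1ℤ * 𝟙 (sameEdge (a , m) (lookup H i))))
      ≡⟨ ∑-*ˡ neighbours (𝟙 R) _ ⟩
    𝟙 R * ∑[ m ∈ neighbours ] (-1ℤ * 𝟙 (sameEdge (a , m) (lookup H i))) ∎
    where
    a : Fin n
    a = proj₁ (lookup G i)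
    R : Bool
    R = sameExcept i G H
    neighbours : List (Fin n)
    neighbours = filter (λ m → ¬? (m ≟ a)) (allFin n)
    factor : ∀ m → -1ℤ * 𝟙 (sameGraph (G [ i ]≔ (a , m)) H)
                 ≡ 𝟙 R * (-1ℤ * 𝟙 (sameEdge (a , m) (lookup H i)))
    factor m = begin
      -1ℤ * 𝟙 (sameGraph (G [ i ]≔ (a , m)) H)          ≡⟨ cong (λ b → -1ℤ * 𝟙 b) (sameGraph-[]≔ˡ i G H (a , m)) ⟩
      -1ℤ * 𝟙 (R ∧ sameEdge (a , m) (lookup H i))        ≡⟨ cong (-1ℤ *_) (𝟙-∧ R _) ⟩
      -1ℤ * (𝟙 R * 𝟙 (sameEdge (a , m) (lookup H i)))    ≡⟨ x∙yz≈y∙xz -1ℤ (𝟙 R) _ ⟩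
      𝟙 R * (-1ℤ * 𝟙 (sameEdge (a , m) (lookup H i)))    ∎
  ... | false = begin
    𝟙 (sameGraph G H) + 0ℤ                                   ≡⟨ ℤ.+-identityʳ _ ⟩
    𝟙 (sameGraph G H)                                        ≡⟨ cong (𝟙 ∘ sameGraph G) (sym ([]≔-lookup H i)) ⟩
    𝟙 (sameGraph G (H [ i ]≔ lookup H i))                    ≡⟨ cong 𝟙 (sameGraph-[]≔ʳ i G H (lookup H i)) ⟩
    𝟙 (sameExcept i G H ∧ sameEdge (lookup G i) (lookup H i)) ≡⟨ 𝟙-∧ (sameExcept i G H) _ ⟩
    𝟙 (sameExcept i G H) * 𝟙 (sameEdge (lookup G i) (lookup H i)) ∎

  Bᵀ-sameExcept : ∀ (i : Fin k) (G H : Graph n k) →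
    Bᵀ i (𝟙 ∘ sameGraph G) H ≡ 𝟙 (sameExcept i G H) * Bᵀ-edge (𝟙 ∘ sameEdge (lookup G i)) (lookup H i)
  Bᵀ-sameExcept i G H =
    trans (Bᵀ-edge-cong (λ h → trans (cong 𝟙 (sameGraph-[]≔ʳ i G H h)) (𝟙-∧ (sameExcept i G H) _)) (lookup H i))
          (Bᵀ-edge-*ˡ (𝟙 (sameExcept i G H)) (𝟙 ∘ sameEdge (lookup G i)) (lookup H i))

  coeff-B : ∀ (i : Fin k) (G H : Graph n k) → coeff (B i G) H ≡ Bᵀ i (𝟙 ∘ sameGraph G) H
  coeff-B i G H = begin
    coeff (B i G) H
      ≡⟨ coeff-B-sameExcept i G H ⟩
    𝟙 (sameExcept i G H) * B-edge-coeff (lookup G i) (lookup H i)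
      ≡⟨ cong (𝟙 (sameExcept i G H) *_) (B-edge-coeff≡Bᵀ-edge (lookup G i) (lookup H i)) ⟩
    𝟙 (sameExcept i G H) * Bᵀ-edge (𝟙 ∘ sameEdge (lookup G i)) (lookup H i)
      ≡⟨ sym (Bᵀ-sameExcept i G H) ⟩
    Bᵀ i (𝟙 ∘ sameGraph G) H ∎

  coeff-linExt-B : ∀ (i : Fin k) (x : LC n k) H → coeff (linExt (B i) x) H ≡ Bᵀ i (coeff x) H
  coeff-linExt-B i x H = begin
    coeff (linExt (B i) x) H
      ≡⟨ coeff-linExt (B i) x H ⟩
    ∑[ cG ∈ x ] (proj₁ cG * coeff (B i (proj₂ cG)) H)
      ≡⟨ ∑-cong x (λ (c , G) → cong (c *_) (coeff-B i G H)) ⟩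
    ∑[ cG ∈ x ] (proj₁ cG * Bᵀ i (𝟙 ∘ sameGraph (proj₂ cG)) H)
      ≡⟨ ∑-cong x (λ (c , G) → sym (Bᵀ-edge-*ˡ c (λ e → 𝟙 (sameGraph G (H [ i ]≔ e))) (lookup H i))) ⟩
    ∑[ cG ∈ x ] Bᵀ i (λ H′ → proj₁ cG * 𝟙 (sameGraph (proj₂ cG) H′)) H
      ≡⟨ sym (Bᵀ-edge-∑ x (λ (c , G) e → c * 𝟙 (sameGraph G (H [ i ]≔ e))) (lookup H i)) ⟩
    Bᵀ i (λ H′ → ∑[ cG ∈ x ] (proj₁ cG * 𝟙 (sameGraph (proj₂ cG) H′))) H
      ≡⟨ Bᵀ-edge-cong (λ e → sym (coeff-∑ x (H [ i ]≔ e))) (lookup H i) ⟩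
    Bᵀ i (coeff x) H ∎

  coeff-Bs : ∀ (is : List (Fin k)) (x : LC n k) H →
             coeff (foldr (λ i acc → linExt (B i) acc) x is) H ≡ Bsᵀ is (coeff x) H
  coeff-Bs []       x H = refl
  coeff-Bs (i ∷ is) x H =
    trans (coeff-linExt-B i (foldr (λ i acc → linExt (B i) acc) x is) H) (Bᵀ-edge-cong (λ e → coeff-Bs is x (H [ i ]≔ e)) (lookup H i))

  coeff-Δ : ∀ (x : LC n k) H → coeff (Δ x) H ≡ Δᵀ (coeff x) H
  coeff-Δ = coeff-Bs (allFin k)

module _ {n : ℕ} where

  sameEdge-swapʳ : ∀ (e : Edge n) c d → sameEdge e (d , c) ≡ sameEdge e (c , d)
  sameEdge-swapʳ (a , b) c d = ∨-comm ((a == d) ∧ (b == c)) ((a == c) ∧ (b == d))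

  sameEdge-ordered : ∀ {a b c d : Fin n} → toℕ a ≤ toℕ b → toℕ c ≤ toℕ d →
                     sameEdge (a , b) (c , d) ≡ (a == c) ∧ (b == d)
  sameEdge-ordered {a} {b} {c} {d} a≤b c≤d with a ≟ c | b ≟ d | a ≟ d | b ≟ c
  ... | yes _    | yes _    | _        | _        = refl
  ... | yes _    | no _     | no _     | _        = refl
  ... | yes _    | no _     | yes _    | no _     = refl
  ... | yes refl | no b≢d   | yes refl | yes refl = ⊥-elim (b≢d refl)
  ... | no _     | _        | no _     | _        = refl
  ... | no _     | _        | yes _    | no _     = refl
  ... | no a≢c   | _        | yes refl | yes refl = ⊥-elim (a≢c (toℕ-injective (≤-antisym a≤b c≤d)))

  ∑-allEdges : ∀ (h : Edge n → ℤ) →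
    ∑ (allEdges n) h ≡ ∑[ a ∈ allFin n ] ∑[ b ∈ allFin n ] (if ⌊ toℕ a ≤? toℕ b ⌋ then h (a , b) else 0ℤ)
  ∑-allEdges h = trans (∑-concatMap _ (allFin n) h) (∑-cong (allFin n) (λ a →
    trans (∑-map (a ,_) (filter (λ b → toℕ a ≤? toℕ b) (allFin n)) h)
          (∑-filter (λ b → toℕ a ≤? toℕ b) (allFin n) (λ b → h (a , b)))))

  ∑-allEdges-sameEdge-ordered : ∀ {c d : Fin n} → toℕ c ≤ toℕ d →
                                ∑[ e ∈ allEdges n ] 𝟙 (sameEdge e (c , d)) ≡ 1ℤ
  ∑-allEdges-sameEdge-ordered {c} {d} c≤d = begin
    ∑[ e ∈ allEdges n ] 𝟙 (sameEdge e (c , d))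
      ≡⟨ ∑-allEdges (λ e → 𝟙 (sameEdge e (c , d))) ⟩
    ∑[ a ∈ allFin n ] ∑[ b ∈ allFin n ] (if ⌊ toℕ a ≤? toℕ b ⌋ then 𝟙 (sameEdge (a , b) (c , d)) else 0ℤ)
      ≡⟨ ∑-cong (allFin n) (λ a → ∑-cong (allFin n) (separate a)) ⟩
    ∑[ a ∈ allFin n ] ∑[ b ∈ allFin n ] (𝟙 (a == c) * 𝟙 (b == d))
      ≡⟨ ∑-cong (allFin n) (λ a → trans (∑-*ˡ (allFin n) (𝟙 (a == c)) _)
                                        (cong (𝟙 (a == c) *_) (∑-𝟙-== d))) ⟩
    ∑[ a ∈ allFin n ] (𝟙 (a == c) * 1ℤ)
      ≡⟨ ∑-cong (allFin n) (λ a → ℤ.*-identityʳ (𝟙 (a == c))) ⟩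
    ∑[ a ∈ allFin n ] 𝟙 (a == c)
      ≡⟨ ∑-𝟙-== c ⟩
    1ℤ ∎
    where
    separate : ∀ a b → (if ⌊ toℕ a ≤? toℕ b ⌋ then 𝟙 (sameEdge (a , b) (c , d)) else 0ℤ)
                     ≡ 𝟙 (a == c) * 𝟙 (b == d)
    separate a b with toℕ a ≤? toℕ b
    ... | yes a≤b = trans (cong 𝟙 (sameEdge-ordered a≤b c≤d)) (𝟙-∧ (a == c) (b == d))
    ... | no a≰b with a ≟ c | b ≟ d
    ...   | yes refl | yes refl = ⊥-elim (a≰b c≤d)
    ...   | yes _    | no _     = refl
    ...   | no _     | _        = refl

  ∑-allEdges-sameEdge : ∀ (e₀ : Edge n) → ∑[ e ∈ allEdges n ] 𝟙 (sameEdge e e₀) ≡ 1ℤ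
  ∑-allEdges-sameEdge (c , d) with toℕ c ≤? toℕ d
  ... | yes c≤d = ∑-allEdges-sameEdge-ordered c≤d
  ... | no c≰d  = trans (∑-cong (allEdges n) (λ e → cong 𝟙 (sym (sameEdge-swapʳ e c d))))
                        (∑-allEdges-sameEdge-ordered (≰⇒≥ c≰d))

  ∑-allGraphs-sameGraph : ∀ k (H : Graph n k) → ∑[ G ∈ allGraphs n k ] 𝟙 (sameGraph G H) ≡ 1ℤ
  ∑-allGraphs-sameGraph ℕ.zero    []       = refl
  ∑-allGraphs-sameGraph (ℕ.suc k) (e₀ ∷ H) = begin
    ∑[ G ∈ allGraphs n (ℕ.suc k) ] 𝟙 (sameGraph G (e₀ ∷ H))
      ≡⟨ ∑-concatMap (λ e → map (e ∷_) (allGraphs n k)) (allEdges n) _ ⟩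
    ∑[ e ∈ allEdges n ] ∑[ G ∈ map (e ∷_) (allGraphs n k) ] 𝟙 (sameGraph G (e₀ ∷ H))
      ≡⟨ ∑-cong (allEdges n) first-edge ⟩
    ∑[ e ∈ allEdges n ] 𝟙 (sameEdge e e₀)
      ≡⟨ ∑-allEdges-sameEdge e₀ ⟩
    1ℤ ∎
    where
    first-edge : ∀ e → ∑[ G ∈ map (e ∷_) (allGraphs n k) ] 𝟙 (sameGraph G (e₀ ∷ H)) ≡ 𝟙 (sameEdge e e₀)
    first-edge e = begin
      ∑[ G ∈ map (e ∷_) (allGraphs n k) ] 𝟙 (sameGraph G (e₀ ∷ H))
        ≡⟨ ∑-map (e ∷_) (allGraphs n k) _ ⟩
      ∑[ G ∈ allGraphs n k ] 𝟙 (sameEdge e e₀ ∧ sameGraph G H)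
        ≡⟨ ∑-cong (allGraphs n k) (λ G → 𝟙-∧ (sameEdge e e₀) (sameGraph G H)) ⟩
      ∑[ G ∈ allGraphs n k ] (𝟙 (sameEdge e e₀) * 𝟙 (sameGraph G H))
        ≡⟨ ∑-*ˡ (allGraphs n k) (𝟙 (sameEdge e e₀)) _ ⟩
      𝟙 (sameEdge e e₀) * ∑[ G ∈ allGraphs n k ] 𝟙 (sameGraph G H)
        ≡⟨ cong (𝟙 (sameEdge e e₀) *_) (∑-allGraphs-sameGraph k H) ⟩
      𝟙 (sameEdge e e₀) * 1ℤ
        ≡⟨ ℤ.*-identityʳ _ ⟩
      𝟙 (sameEdge e e₀) ∎

  ∑-allGraphs-sift : ∀ {k} (Q : Graph n k → ℤ) H → (∀ G → sameGraph G H ≡ true → Q G ≡ Q H) →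
                     ∑[ G ∈ allGraphs n k ] (Q G * 𝟙 (sameGraph G H)) ≡ Q H
  ∑-allGraphs-sift {k} Q H Q-invariant = begin
    ∑[ G ∈ allGraphs n k ] (Q G * 𝟙 (sameGraph G H))  ≡⟨ ∑-cong (allGraphs n k) replace ⟩
    ∑[ G ∈ allGraphs n k ] (Q H * 𝟙 (sameGraph G H))  ≡⟨ ∑-*ˡ (allGraphs n k) (Q H) _ ⟩
    Q H * ∑[ G ∈ allGraphs n k ] 𝟙 (sameGraph G H)    ≡⟨ cong (Q H *_) (∑-allGraphs-sameGraph k H) ⟩
    Q H * 1ℤ                                           ≡⟨ ℤ.*-identityʳ (Q H) ⟩
    Q H                                                ∎
    where
    replace : ∀ G → Q G * 𝟙 (sameGraph G H) ≡ Q H * 𝟙 (sameGraph G H)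
    replace G with sameGraph G H in G~H
    ... | true  = cong (_* 1ℤ) (Q-invariant G G~H)
    ... | false = trans (ℤ.*-zeroʳ (Q G)) (sym (ℤ.*-zeroʳ (Q H)))

==-sym : ∀ {n} (a b : Fin n) → (a == b) ≡ (b == a)
==-sym a b with a ≟ b | b ≟ a
... | yes _ | yes _ = refl
... | no _  | no _  = refl
... | yes p | no ¬q = ⊥-elim (¬q (sym p))
... | no ¬p | yes q = ⊥-elim (¬p (sym q))

sameEdge⇒≡⊎swap : ∀ {n} (e e′ : Edge n) → sameEdge e e′ ≡ true → e ≡ e′ ⊎ e ≡ swap e′
sameEdge⇒≡⊎swap (a , b) (c , d) e~e′ with a ≟ c | b ≟ d | a ≟ d | b ≟ c
... | yes refl | yes refl | _        | _        = inj₁ refl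
... | yes _    | no _     | yes refl | yes refl = inj₂ refl
... | no _     | _        | yes refl | yes refl = inj₂ refl
sameEdge⇒≡⊎swap _ _ () | yes _ | no _ | yes _ | no _
sameEdge⇒≡⊎swap _ _ () | yes _ | no _ | no _  | _
sameEdge⇒≡⊎swap _ _ () | no _  | _    | yes _ | no _
sameEdge⇒≡⊎swap _ _ () | no _  | _    | no _  | _

respects-sameEdge : ∀ {n} {u : Edge n → ℤ} → (∀ a b → u (a , b) ≡ u (b , a)) →
                    ∀ e e′ → sameEdge e e′ ≡ true → u e ≡ u e′
respects-sameEdge u-sym e e′ e~e′ with sameEdge⇒≡⊎swap e e′ e~e′
... | inj₁ refl = refl
... | inj₂ refl = u-sym (proj₂ e′) (proj₁ e′)

∏-sameGraph : ∀ {n k} {u : Edge n → ℤ} → (∀ a b → u (a , b) ≡ u (b , a)) →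
              ∀ (G H : Graph n k) → sameGraph G H ≡ true → ∏ u G ≡ ∏ u H
∏-sameGraph u-sym []      []      _   = refl
∏-sameGraph u-sym (e ∷ G) (f ∷ H) G~H with sameEdge e f in e~f
... | true = cong₂ _*_ (respects-sameEdge u-sym e f e~f) (∏-sameGraph u-sym G H G~H)

module _ {n q : ℕ} where

  monoWeight : ℤ → Vec (Fin q) n → Edge n → ℤ
  monoWeight v f (a , b) = if lookup f a == lookup f b then 1ℤ + v else 1ℤ

  weight : ℤ → ℤ → Vec (Fin q) n → Edge n → ℤ
  weight ℓ v f (a , b) = if a == b then ℓ else monoWeight v f (a , b)

  weight-sym : ∀ ℓ v f (a b : Fin n) → weight ℓ v f (a , b) ≡ weight ℓ v f (b , a)
  weight-sym ℓ v f a b =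
    cong₂ (λ x y → if x then ℓ else (if y then 1ℤ + v else 1ℤ)) (==-sym a b) (==-sym (lookup f a) (lookup f b))

  ^-monoCount-∷ : ∀ v f (e : Edge n) es →
                  (1ℤ + v) ^ monoCount f (e ∷ es) ≡ monoWeight v f e * (1ℤ + v) ^ monoCount f es
  ^-monoCount-∷ v f (a , b) es with lookup f a == lookup f b
  ... | true  = refl
  ... | false = sym (ℤ.*-identityˡ _)

  ∏-weight-1 : ∀ {k} v f (G : Graph n k) → (1ℤ + v) ^ monoCount f (deleteLoops G) ≡ ∏ (weight 1ℤ v f) G
  ∏-weight-1 v f []            = refl
  ∏-weight-1 v f ((a , b) ∷ G) with a ≟ b
  ... | yes refl = trans (∏-weight-1 v f G) (sym (ℤ.*-identityˡ _))
  ... | no _     = trans (^-monoCount-∷ v f (a , b) (deleteLoops G))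
                         (cong (monoWeight v f (a , b) *_) (∏-weight-1 v f G))

  ∏-weight-0 : ∀ {k} v f (G : Graph n k) →
               ∏ (weight 0ℤ v f) G ≡ (if loopless G then (1ℤ + v) ^ monoCount f (toList G) else 0ℤ)
  ∏-weight-0 v f []            = refl
  ∏-weight-0 v f ((a , b) ∷ G) with a == b
  ... | true  = refl
  ... | false with loopless G | ∏-weight-0 v f G
  ...   | true  | ih = trans (cong (monoWeight v f (a , b) *_) ih) (sym (^-monoCount-∷ v f (a , b) (toList G)))
  ...   | false | ih = trans (cong (monoWeight v f (a , b) *_) ih) (ℤ.*-zeroʳ (monoWeight v f (a , b)))

loopWeightedPotts : ∀ {n k} → ℤ → ℕ → ℤ → Graph n k → ℤ
loopWeightedPotts {n} ℓ q v G = ∑[ f ∈ allColourings n q ] ∏ (weight ℓ v f) G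

module _ {n k : ℕ} (q : ℕ) (v : ℤ) where

  loopWeightedPotts-sameGraph : ∀ ℓ (G H : Graph n k) → sameGraph G H ≡ true →
                                loopWeightedPotts ℓ q v G ≡ loopWeightedPotts ℓ q v H
  loopWeightedPotts-sameGraph ℓ G H G~H =
    ∑-cong (allColourings n q) (λ f → ∏-sameGraph (weight-sym ℓ v f) G H G~H)

  Potts-deleteLoops : ∀ (G : Graph n k) → Potts q v (deleteLoops G) ≡ loopWeightedPotts 1ℤ q v G
  Potts-deleteLoops G = ∑-cong (allColourings n q) (λ f → ∏-weight-1 v f G)

  loopWeightedPotts-0 : ∀ (G : Graph n k) →
                        loopWeightedPotts 0ℤ q v G ≡ (if loopless G then Potts q v (toList G) else 0ℤ)
  loopWeightedPotts-0 G = trans (∑-cong (allColourings n q) (λ f → ∏-weight-0 v f G)) (∑-if (loopless G))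
    where
    ∑-if : ∀ b → ∑[ f ∈ allColourings n q ] (if b then (1ℤ + v) ^ monoCount f (toList G) else 0ℤ)
               ≡ (if b then Potts q v (toList G) else 0ℤ)
    ∑-if true  = refl
    ∑-if false = ∑-zero (allColourings n q)

  coeff-𝒵 : ∀ (H : Graph n k) → coeff (𝒵 n k q v) H ≡ loopWeightedPotts 1ℤ q v H
  coeff-𝒵 H = begin
    coeff (𝒵 n k q v) H
      ≡⟨ coeff-map (λ G → Potts q v (deleteLoops G)) id (allGraphs n k) H ⟩
    ∑[ G ∈ allGraphs n k ] (Potts q v (deleteLoops G) * 𝟙 (sameGraph G H))
      ≡⟨ ∑-cong (allGraphs n k) (λ G → cong (_* 𝟙 (sameGraph G H)) (Potts-deleteLoops G)) ⟩
    ∑[ G ∈ allGraphs n k ] (loopWeightedPotts 1ℤ q v G * 𝟙 (sameGraph G H))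
      ≡⟨ ∑-allGraphs-sift (loopWeightedPotts 1ℤ q v) H (λ G → loopWeightedPotts-sameGraph 1ℤ G H) ⟩
    loopWeightedPotts 1ℤ q v H ∎

  coeff-𝒵̂ : ∀ (H : Graph n k) → coeff (𝒵̂ n k q v) H ≡ loopWeightedPotts 0ℤ q v H
  coeff-𝒵̂ H = begin
    coeff (𝒵̂ n k q v) H
      ≡⟨ coeff-map (λ G → Potts q v (toList G)) id (filter loopless? (allGraphs n k)) H ⟩
    ∑[ G ∈ filter loopless? (allGraphs n k) ] (Potts q v (toList G) * 𝟙 (sameGraph G H))
      ≡⟨ ∑-filter loopless? (allGraphs n k) _ ⟩
    ∑[ G ∈ allGraphs n k ] (if ⌊ loopless? G ⌋ then Potts q v (toList G) * 𝟙 (sameGraph G H) else 0ℤ)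
      ≡⟨ ∑-cong (allGraphs n k) (λ G → trans (if-loopless G) (cong (_* 𝟙 (sameGraph G H)) (sym (loopWeightedPotts-0 G)))) ⟩
    ∑[ G ∈ allGraphs n k ] (loopWeightedPotts 0ℤ q v G * 𝟙 (sameGraph G H))
      ≡⟨ ∑-allGraphs-sift (loopWeightedPotts 0ℤ q v) H (λ G → loopWeightedPotts-sameGraph 0ℤ G H) ⟩
    loopWeightedPotts 0ℤ q v H ∎
    where
    loopless? : Decidable (λ G → loopless G ≡ true)
    loopless? G = loopless G Bool.≟ true
    if-loopless : ∀ G → (if ⌊ loopless? G ⌋ then Potts q v (toList G) * 𝟙 (sameGraph G H) else 0ℤ)
                      ≡ (if loopless G then Potts q v (toList G) else 0ℤ) * 𝟙 (sameGraph G H)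
    if-loopless G with loopless G
    ... | true  = refl
    ... | false = refl

Bᵀ-edge-weight : ∀ {n q} v (f : Vec (Fin q) n) e → Bᵀ-edge (weight 1ℤ v f) e ≡ -1ℤ * weight 0ℤ (- v) f e
Bᵀ-edge-weight v f (a , b) with a ≟ b
... | yes refl = refl
... | no _     = trans (cong₂ (λ x y → monoWeight v f (a , b) - x - y) (loop-weight a) (loop-weight b))
                       (mono (lookup f a == lookup f b))
  where
  loop-weight : ∀ x → weight 1ℤ v f (x , x) ≡ 1ℤ
  loop-weight x = if-cong {x = 1ℤ} (trans (isYes≗does (x ≟ x)) (dec-true (x ≟ x) refl))
  flip : ∀ v → (1ℤ + v) - 1ℤ - 1ℤ ≡ -1ℤ * (1ℤ + - v)
  flip = solve-∀
  mono : ∀ m → (if m then 1ℤ + v else 1ℤ) - 1ℤ - 1ℤ ≡ -1ℤ * (if m then 1ℤ + - v else 1ℤ)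
  mono true  = flip v
  mono false = refl

theorem1p2 : (n k : ℕ) → n ≥ 1 → (q : ℕ) → (v : ℤ) → (H : Graph n k) →
    coeff (Δ (𝒵 n k q v)) H ≡ (-1ℤ ^ k) * coeff (𝒵̂ n k q (- v)) H
-- The argument never uses n ≥ 1.
theorem1p2 n k _ q v H = begin
  coeff (Δ (𝒵 n k q v)) H
    ≡⟨ coeff-Δ (𝒵 n k q v) H ⟩
  Δᵀ (coeff (𝒵 n k q v)) H
    ≡⟨ Bsᵀ-cong (allFin k) (coeff-𝒵 q v) H ⟩
  Δᵀ (loopWeightedPotts 1ℤ q v) H
    ≡⟨ Bsᵀ-∑ (allFin k) (allColourings n q) (λ f → ∏ (weight 1ℤ v f)) H ⟩
  ∑[ f ∈ allColourings n q ] Δᵀ (∏ (weight 1ℤ v f)) H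
    ≡⟨ ∑-cong (allColourings n q) (λ f → Δᵀ-∏ k (weight 1ℤ v f) H) ⟩
  ∑[ f ∈ allColourings n q ] ∏ (Bᵀ-edge (weight 1ℤ v f)) H
    ≡⟨ ∑-cong (allColourings n q) (λ f → ∏-cong (Bᵀ-edge-weight v f) H) ⟩
  ∑[ f ∈ allColourings n q ] ∏ (λ e → -1ℤ * weight 0ℤ (- v) f e) H
    ≡⟨ ∑-cong (allColourings n q) (λ f → ∏-*ˡ k -1ℤ (weight 0ℤ (- v) f) H) ⟩
  ∑[ f ∈ allColourings n q ] ((-1ℤ ^ k) * ∏ (weight 0ℤ (- v) f) H)
    ≡⟨ ∑-*ˡ (allColourings n q) (-1ℤ ^ k) (λ f → ∏ (weight 0ℤ (- v) f) H) ⟩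
  (-1ℤ ^ k) * loopWeightedPotts 0ℤ q (- v) H
    ≡⟨ cong ((-1ℤ ^ k) *_) (sym (coeff-𝒵̂ q (- v) H)) ⟩
  (-1ℤ ^ k) * coeff (𝒵̂ n k q (- v)) H ∎
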